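{- Let $p>3$ be a prime. Then $$\sum_{j=0}^{(p-3)/2}\frac{(-1)^j}{2j+1}\equiv\left(\frac{ -1}{p}\right)\frac{2^{p-1}-1}{2p}\pmod p.$$
   Context: $\left(\frac{ -1}{p}\right)$ is the Legendre symbol. Congruences of rationals with denominators prime to $p$ are understood in the ring of rationals with denominator prime to $p$. -}

module Defs where

open import Data.Nat as ℕ using (ℕ; zero; suc; NonZero)
open import Data.Nat.Divisibility using (_∣_; _∣?_)
open import Data.Integer as ℤ using (ℤ; +_; ∣_∣)
open import Data.Rational as ℚ using (ℚ; ↥_; ↧ₙ_)
open import Data.List using (List; upTo; map; foldr)
open import Data.List.Relation.Unary.Any using (any?)
open import Relation.Nullary using (¬_; yes; no)
open import Data.Product using (_×_)

legendre : ℤ → ℕ → ℤ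
legendre a p with p ∣? ∣ a ∣
... | yes _ = + 0
... | no _ with any? (λ x → p ∣? ∣ (+ x ℤ.* + x) ℤ.- a ∣) (upTo p)
...   | yes _ = + 1
...   | no _  = ℤ.- (+ 1)

PIntegral : ℕ → ℚ → Set
PIntegral p q = ¬ (p ∣ ↧ₙ q)

_≡_[modℚ_] : ℚ → ℚ → ℕ → Set
a ≡ b [modℚ p ] = PIntegral p a × PIntegral p b × (p ∣ ∣ ↥ (a ℚ.- b) ∣)

term : ℕ → ℚ
term j = ((ℤ.- (+ 1)) ℤ.^ j) ℚ./ suc (2 ℕ.* j)

sumTerms : ℕ → ℚ
sumTerms n = foldr ℚ._+_ ℚ.0ℚ (map term (upTo n))

module Submission where

open import Data.Bool using (true; false)
open import Data.Integer as ℤ using (ℤ; +_; _+_; _*_; -_; _-_; ∣_∣)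
import Data.Integer.Properties as ℤ
open import Data.Integer.Divisibility.Signed using (_∣_; divides; ∣ᵤ⇒∣; ∣⇒∣ᵤ; ∣m∣n⇒∣m+n; ∣m⇒∣-m; ∣n⇒∣m*n)
open import Data.Integer.Tactic.RingSolver using (solve-∀)
open import Data.List using (upTo; applyUpTo; foldr)
import Data.List.Properties as List
open import Data.List.Membership.Propositional.Properties using (∈-upTo⁺)
open import Data.List.Relation.Unary.Any as Any using (Any; any?; satisfied)
open import Data.Nat as ℕ using (ℕ; zero; suc; z≤n; s≤s; NonZero; _>_; _∸_; _^_)
open import Data.Nat.Combinatorics using (_C_; nCn≡1; nC1≡n; nCk+nC[k+1]≡[n+1]C[k+1])
import Data.Nat.Coprimality as Coprimality
import Data.Nat.Divisibility as ℕ
open import Data.Nat.DivMod using (_%_; _/_; m≡m%n+[m/n]*n; m%n<n; m/n*n≡m; m*n/n≡m)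
open import Data.Nat.Primality using (Prime; euclidsLemma; prime⇒nonTrivial; prime⇒irreducible)
import Data.Nat.Properties as ℕ
open import Data.Nat.Tactic.RingSolver using () renaming (solve-∀ to ℕ-solve-∀)
open import Data.Product using (∃; _×_; _,_; proj₁; proj₂)
open import Data.Rational as ℚ using (ℚ; mkℚ; toℚᵘ)
import Data.Rational.Properties as ℚ
open import Data.Rational.Unnormalised as ℚᵘ using (ℚᵘ; mkℚᵘ; _≃_; *≡*)
import Data.Rational.Unnormalised.Properties as ℚᵘ
open import Data.Rational.Unnormalised.Solver using (module +-*-Solver)
open import Data.Sum using (_⊎_; inj₁; inj₂)
open import Function using (_∘_)
open import Relation.Binary.Bundles using (Setoid)
open import Relation.Binary.PropositionalEquality
import Relation.Binary.Reasoning.Setoid as SetoidReasoning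
open import Relation.Nullary using (¬_; Dec; yes; no; ¬?; contradiction)
open import Relation.Nullary.Decidable using (decidable-stable)
open import Relation.Nullary.Reflects using (ofʸ)
open import Defs

-- Write p = 2n + 1 and Mₖ = C(p, k)/p for 0 < k < p. Since (2j + 1)·M₂ⱼ₊₁ = C(p − 1, 2j) ≡ 1,
-- the sum is ≡ B = ∑_{j<n} (−1)ʲ M₂ⱼ₊₁ (mod p). By the binomial theorem the imaginary part A
-- of (1 + i)ᵖ is (−1)ⁿ + pB, and (1 + i)ᵖ = (1 + i)(2i)ⁿ gives A² = 2ᵖ⁻¹. Hence
-- 2ᵖ⁻¹ − 1 = A² − 1 = pB(A + (−1)ⁿ), so the right-hand side is (−1/p)·B·(A + (−1)ⁿ)/2, which
-- is ≡ B because A ≡ (−1)ⁿ and (−1/p) = (−1)ⁿ. The last fact is Euler's criterion for −1: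
-- some x has xⁿ ≡ −1, for otherwise every unit is a root of xⁿ − 1 and ∑ₖ kⁿ ≡ p − 1, while
-- C(p − 1, k) ≡ (−1)ᵏ turns ∑ₖ kⁿ into a (p − 1)-st finite difference of a polynomial of
-- degree n < p − 1, which vanishes.

-- Finite sums and binomial coefficients

∑ : ℕ → (ℕ → ℤ) → ℤ
∑ zero    f = + 0
∑ (suc n) f = f 0 + ∑ n (f ∘ suc)

infix 10 ∑
syntax ∑ n (λ k → e) = ∑[ k < n ] e

∑-cong : ∀ n {f g : ℕ → ℤ} → (∀ k → k ℕ.< n → f k ≡ g k) → ∑ n f ≡ ∑ n g
∑-cong zero    f≡g = refl
∑-cong (suc n) f≡g = cong₂ _+_ (f≡g 0 (s≤s z≤n)) (∑-cong n (λ k k<n → f≡g (suc k) (s≤s k<n)))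

∑-zero : ∀ n → ∑[ k < n ] (+ 0) ≡ + 0
∑-zero zero    = refl
∑-zero (suc n) = trans (ℤ.+-identityˡ _) (∑-zero n)

∑-+ : ∀ n (f g : ℕ → ℤ) → ∑[ k < n ] (f k + g k) ≡ ∑ n f + ∑ n g
∑-+ zero    f g = refl
∑-+ (suc n) f g = trans (cong (_+_ (f 0 + g 0)) (∑-+ n (f ∘ suc) (g ∘ suc))) (interchange (f 0) (g 0) _ _)
  where
  interchange : ∀ a b c d → (a + b) + (c + d) ≡ (a + c) + (b + d)
  interchange = solve-∀

∑-*ˡ : ∀ n a (f : ℕ → ℤ) → ∑[ k < n ] (a * f k) ≡ a * ∑ n f
∑-*ˡ zero    a f = sym (ℤ.*-zeroʳ a)
∑-*ˡ (suc n) a f = trans (cong (_+_ (a * f 0)) (∑-*ˡ n a (f ∘ suc))) (sym (ℤ.*-distribˡ-+ a (f 0) _))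

∑-neg : ∀ n (f : ℕ → ℤ) → ∑[ k < n ] (- f k) ≡ - ∑ n f
∑-neg zero    f = refl
∑-neg (suc n) f = trans (cong (_+_ (- f 0)) (∑-neg n (f ∘ suc))) (sym (ℤ.neg-distrib-+ (f 0) _))

∑-init-last : ∀ n (f : ℕ → ℤ) → ∑ (suc n) f ≡ ∑ n f + f n
∑-init-last zero    f = trans (ℤ.+-identityʳ (f 0)) (sym (ℤ.+-identityˡ (f 0)))
∑-init-last (suc n) f = trans (cong (_+_ (f 0)) (∑-init-last n (f ∘ suc))) (sym (ℤ.+-assoc (f 0) _ _))

∑-even-odd : ∀ n (f : ℕ → ℤ) → ∑ (2 ℕ.* n) f ≡ ∑[ j < n ] (f (2 ℕ.* j) + f (suc (2 ℕ.* j)))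
∑-even-odd zero    f = refl
∑-even-odd (suc n) f = begin
  ∑ (2 ℕ.* suc n) f                                ≡⟨ cong (λ m → ∑ m f) (2[1+n]≡2+2n n) ⟩
  f 0 + (f 1 + ∑ (2 ℕ.* n) (f ∘ suc ∘ suc))        ≡⟨ cong (λ s → f 0 + (f 1 + s)) (∑-even-odd n (f ∘ suc ∘ suc)) ⟩
  f 0 + (f 1 + ∑[ j < n ] (f (2 ℕ.+ 2 ℕ.* j) + f (3 ℕ.+ 2 ℕ.* j)))
    ≡⟨ sym (ℤ.+-assoc (f 0) (f 1) _) ⟩
  f 0 + f 1 + ∑[ j < n ] (f (2 ℕ.+ 2 ℕ.* j) + f (3 ℕ.+ 2 ℕ.* j))
    ≡⟨ cong (_+_ (f 0 + f 1)) (∑-cong n (λ j _ → cong (λ m → f m + f (suc m)) (sym (2[1+n]≡2+2n j)))) ⟩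
  ∑[ j < suc n ] (f (2 ℕ.* j) + f (suc (2 ℕ.* j))) ∎
  where
  open ≡-Reasoning
  2[1+n]≡2+2n : ∀ n → 2 ℕ.* suc n ≡ 2 ℕ.+ 2 ℕ.* n
  2[1+n]≡2+2n n = ℕ.*-distribˡ-+ 2 1 n

∑-const : ∀ n → ∑[ k < n ] (+ 1) ≡ + n
∑-const zero    = refl
∑-const (suc n) = trans (cong (_+_ (+ 1)) (∑-const n)) (sym (ℤ.pos-+ 1 n))

pos-^ : ∀ a n → + (a ℕ.^ n) ≡ (+ a) ℤ.^ n
pos-^ a zero    = refl
pos-^ a (suc n) = trans (ℤ.pos-* a (a ℕ.^ n)) (cong (_*_ (+ a)) (pos-^ a n))

i^[n+n]≡[i*i]^n : ∀ i n → i ℤ.^ (n ℕ.+ n) ≡ (i * i) ℤ.^ n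
i^[n+n]≡[i*i]^n i n = trans (ℤ.^-distribˡ-+-* i n n) (square-^ n)
  where
  square-^ : ∀ n → i ℤ.^ n * i ℤ.^ n ≡ (i * i) ℤ.^ n
  square-^ zero    = refl
  square-^ (suc n) = trans (interchange i (i ℤ.^ n)) (cong (_*_ (i * i)) (square-^ n))
    where
    interchange : ∀ a b → (a * b) * (a * b) ≡ (a * a) * (b * b)
    interchange = solve-∀

-1^ : ℕ → ℤ
-1^ k = (- + 1) ℤ.^ k

-1^-suc : ∀ k → -1^ (suc k) ≡ - -1^ k
-1^-suc k = ℤ.-1*i≡-i (-1^ k)

-1^k*-1^k≡1 : ∀ k → -1^ k * -1^ k ≡ + 1
-1^k*-1^k≡1 zero    = refl
-1^k*-1^k≡1 (suc k) = trans (square-neg (-1^ k)) (-1^k*-1^k≡1 k)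
  where
  square-neg : ∀ a → (- + 1 * a) * (- + 1 * a) ≡ a * a
  square-neg = solve-∀

-1^[k+k]≡1 : ∀ k → -1^ (k ℕ.+ k) ≡ + 1
-1^[k+k]≡1 k = trans (ℤ.^-distribˡ-+-* (- + 1) k k) (-1^k*-1^k≡1 k)

n<k⇒nCk≡0 : ∀ {n k} → n ℕ.< k → n C k ≡ 0
n<k⇒nCk≡0 {n} {k} n<k with k ℕ.≤ᵇ n | ℕ.≤ᵇ-reflects-≤ k n
... | false | _       = refl
... | true  | ofʸ k≤n = contradiction k≤n (ℕ.<⇒≱ n<k)

[k+1]*[n+1]C[k+1]≡[n+1]*nCk : ∀ n k → suc k ℕ.* (suc n C suc k) ≡ suc n ℕ.* (n C k)
[k+1]*[n+1]C[k+1]≡[n+1]*nCk zero    zero    = refl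
[k+1]*[n+1]C[k+1]≡[n+1]*nCk zero    (suc k) = begin
  suc (suc k) ℕ.* (1 C suc (suc k)) ≡⟨ cong (suc (suc k) ℕ.*_) (n<k⇒nCk≡0 {1} {suc (suc k)} (s≤s (s≤s z≤n))) ⟩
  suc (suc k) ℕ.* 0                 ≡⟨ ℕ.*-zeroʳ (suc (suc k)) ⟩
  0                                 ≡⟨ cong (1 ℕ.*_) (n<k⇒nCk≡0 {0} {suc k} (s≤s z≤n)) ⟨
  1 ℕ.* (0 C suc k)                 ∎
  where open ≡-Reasoning
[k+1]*[n+1]C[k+1]≡[n+1]*nCk (suc n) zero    = trans (ℕ.*-identityˡ (suc (suc n) C 1)) (trans (nC1≡n (suc (suc n))) (sym (ℕ.*-identityʳ (suc (suc n)))))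
[k+1]*[n+1]C[k+1]≡[n+1]*nCk (suc n) (suc k) = begin
  suc (suc k) ℕ.* (suc (suc n) C suc (suc k))
    ≡⟨ cong (suc (suc k) ℕ.*_) (sym (nCk+nC[k+1]≡[n+1]C[k+1] (suc n) (suc k))) ⟩
  suc (suc k) ℕ.* (a ℕ.+ b)
    ≡⟨ expand (suc k) a b ⟩
  a ℕ.+ suc k ℕ.* a ℕ.+ suc (suc k) ℕ.* b
    ≡⟨ cong₂ (λ x y → a ℕ.+ x ℕ.+ y) ([k+1]*[n+1]C[k+1]≡[n+1]*nCk n k) ([k+1]*[n+1]C[k+1]≡[n+1]*nCk n (suc k)) ⟩
  a ℕ.+ suc n ℕ.* (n C k) ℕ.+ suc n ℕ.* (n C suc k)
    ≡⟨ collect (suc n) a (n C k) (n C suc k) ⟩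
  a ℕ.+ suc n ℕ.* (n C k ℕ.+ n C suc k)
    ≡⟨ cong (λ x → a ℕ.+ suc n ℕ.* x) (nCk+nC[k+1]≡[n+1]C[k+1] n k) ⟩
  suc (suc n) ℕ.* a ∎
  where
  open ≡-Reasoning
  a = suc n C suc k
  b = suc n C suc (suc k)
  expand : ∀ k a b → (1 ℕ.+ k) ℕ.* (a ℕ.+ b) ≡ a ℕ.+ k ℕ.* a ℕ.+ (1 ℕ.+ k) ℕ.* b
  expand = ℕ-solve-∀
  collect : ∀ m a x y → a ℕ.+ m ℕ.* x ℕ.+ m ℕ.* y ≡ a ℕ.+ m ℕ.* (x ℕ.+ y)
  collect = ℕ-solve-∀

binomialSum : ℕ → (ℕ → ℤ) → ℤ
binomialSum m g = ∑[ k < suc m ] (+ (m C k) * g k)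

binomialSum-cong : ∀ m {g h : ℕ → ℤ} → (∀ k → g k ≡ h k) → binomialSum m g ≡ binomialSum m h
binomialSum-cong m {g} {h} g≡h = ∑-cong (suc m) {λ k → + (m C k) * g k} {λ k → + (m C k) * h k} (λ k _ → cong (_*_ (+ (m C k))) (g≡h k))

binomialSum-neg : ∀ m (g : ℕ → ℤ) → binomialSum m (λ k → - g k) ≡ - binomialSum m g
binomialSum-neg m g =
  trans (∑-cong (suc m) (λ k _ → sym (ℤ.neg-distribʳ-* (+ (m C k)) (g k)))) (∑-neg (suc m) (λ k → + (m C k) * g k))

binomialSum-suc : ∀ m (g : ℕ → ℤ) → binomialSum (suc m) g ≡ binomialSum m g + binomialSum m (g ∘ suc)
binomialSum-suc m g = begin
  binomialSum (suc m) g
    ≡⟨⟩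
  + 1 * g 0 + ∑[ k < suc m ] (+ (suc m C suc k) * g (suc k))
    ≡⟨ cong (_+_ (+ 1 * g 0)) (∑-cong (suc m) λ k _ → pascal k) ⟩
  + 1 * g 0 + ∑[ k < suc m ] (+ (m C k) * g (suc k) + + (m C suc k) * g (suc k))
    ≡⟨ cong (_+_ (+ 1 * g 0)) (∑-+ (suc m) (λ k → + (m C k) * g (suc k)) (λ k → + (m C suc k) * g (suc k))) ⟩
  + 1 * g 0 + (binomialSum m (g ∘ suc) + ∑[ k < suc m ] (+ (m C suc k) * g (suc k)))
    ≡⟨ rearrange (+ 1 * g 0) _ _ ⟩
  ∑[ k < suc (suc m) ] (+ (m C k) * g k) + binomialSum m (g ∘ suc)
    ≡⟨ cong (_+ binomialSum m (g ∘ suc)) lastTermVanishes ⟩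
  binomialSum m g + binomialSum m (g ∘ suc) ∎
  where
  open ≡-Reasoning
  pascal : ∀ k → + (suc m C suc k) * g (suc k) ≡ + (m C k) * g (suc k) + + (m C suc k) * g (suc k)
  pascal k = begin
    + (suc m C suc k) * g (suc k)              ≡⟨ cong (λ c → + c * g (suc k)) (nCk+nC[k+1]≡[n+1]C[k+1] m k) ⟨
    + (m C k ℕ.+ m C suc k) * g (suc k)        ≡⟨ ℤ.*-distribʳ-+ (g (suc k)) (+ (m C k)) (+ (m C suc k)) ⟩
    + (m C k) * g (suc k) + + (m C suc k) * g (suc k) ∎
  rearrange : ∀ a b c → a + (b + c) ≡ (a + c) + b
  rearrange = solve-∀
  lastTermVanishes : ∑[ k < suc (suc m) ] (+ (m C k) * g k) ≡ binomialSum m g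
  lastTermVanishes = begin
    ∑[ k < suc (suc m) ] (+ (m C k) * g k)          ≡⟨ ∑-init-last (suc m) (λ k → + (m C k) * g k) ⟩
    binomialSum m g + + (m C suc m) * g (suc m)      ≡⟨ cong (λ c → binomialSum m g + + c * g (suc m)) (n<k⇒nCk≡0 {m} {suc m} (ℕ.n<1+n m)) ⟩
    binomialSum m g + + 0 * g (suc m)                ≡⟨ ℤ.+-identityʳ (binomialSum m g) ⟩
    binomialSum m g ∎

1+a^n≡binomialSum : ∀ n a → (+ 1 + a) ℤ.^ n ≡ binomialSum n (a ℤ.^_)
1+a^n≡binomialSum zero    a = refl
1+a^n≡binomialSum (suc n) a = begin
  (+ 1 + a) * (+ 1 + a) ℤ.^ n                      ≡⟨ cong ((+ 1 + a) *_) (1+a^n≡binomialSum n a) ⟩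
  (+ 1 + a) * S                                    ≡⟨ distrib a S ⟩
  S + a * S                                        ≡⟨ cong (_+_ S) (∑-*ˡ (suc n) a (λ k → + (n C k) * a ℤ.^ k)) ⟨
  S + ∑[ k < suc n ] (a * (+ (n C k) * a ℤ.^ k))   ≡⟨ cong (_+_ S) (∑-cong (suc n) λ k _ → swap a (+ (n C k)) (a ℤ.^ k)) ⟩
  S + binomialSum n (λ k → a ℤ.^ suc k)            ≡⟨ binomialSum-suc n (a ℤ.^_) ⟨
  binomialSum (suc n) (a ℤ.^_)                     ∎
  where
  open ≡-Reasoning
  S = binomialSum n (a ℤ.^_)
  distrib : ∀ a s → (+ 1 + a) * s ≡ s + a * s
  distrib = solve-∀
  swap : ∀ a c x → a * (c * x) ≡ c * (a * x)
  swap = solve-∀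

module Congruence (m : ℕ) where

  infix 4 _≈_
  record _≈_ (a b : ℤ) : Set where
    constructor mod∣
    field divides-difference : + m ∣ a - b

  private
    via : ∀ {a b x} → x ≡ a - b → + m ∣ x → a ≈ b
    via eq m∣x = mod∣ (subst (+ m ∣_) eq m∣x)

  ≈-refl : ∀ {a} → a ≈ a
  ≈-refl {a} = via (sym (ℤ.+-inverseʳ a)) (divides (+ 0) refl)

  ≈-reflexive : ∀ {a b} → a ≡ b → a ≈ b
  ≈-reflexive refl = ≈-refl

  ≈-sym : ∀ {a b} → a ≈ b → b ≈ a
  ≈-sym {a} {b} (mod∣ m∣a-b) = via (flip a b) (∣m⇒∣-m m∣a-b)
    where
    flip : ∀ a b → - (a - b) ≡ b - a
    flip = solve-∀

  ≈-trans : ∀ {a b c} → a ≈ b → b ≈ c → a ≈ c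
  ≈-trans {a} {b} {c} (mod∣ m∣a-b) (mod∣ m∣b-c) = via (telescope a b c) (∣m∣n⇒∣m+n m∣a-b m∣b-c)
    where
    telescope : ∀ a b c → (a - b) + (b - c) ≡ a - c
    telescope = solve-∀

  ≈-setoid : Setoid _ _
  ≈-setoid = record
    { Carrier = ℤ ; _≈_ = _≈_
    ; isEquivalence = record { refl = ≈-refl ; sym = ≈-sym ; trans = ≈-trans } }

  +-cong : ∀ {a b c d} → a ≈ b → c ≈ d → a + c ≈ b + d
  +-cong {a} {b} {c} {d} (mod∣ m∣a-b) (mod∣ m∣c-d) = via (regroup a b c d) (∣m∣n⇒∣m+n m∣a-b m∣c-d)
    where
    regroup : ∀ a b c d → (a - b) + (c - d) ≡ (a + c) - (b + d)
    regroup = solve-∀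

  neg-cong : ∀ {a b} → a ≈ b → - a ≈ - b
  neg-cong {a} {b} (mod∣ m∣a-b) = via (regroup a b) (∣m⇒∣-m m∣a-b)
    where
    regroup : ∀ a b → - (a - b) ≡ - a - - b
    regroup = solve-∀

  *-cong : ∀ {a b c d} → a ≈ b → c ≈ d → a * c ≈ b * d
  *-cong {a} {b} {c} {d} (mod∣ m∣a-b) (mod∣ m∣c-d) =
    via (regroup a b c d) (∣m∣n⇒∣m+n (∣n⇒∣m*n a m∣c-d) (∣n⇒∣m*n d m∣a-b))
    where
    regroup : ∀ a b c d → a * (c - d) + d * (a - b) ≡ a * c - b * d
    regroup = solve-∀

  ^-cong : ∀ {a b} n → a ≈ b → a ℤ.^ n ≈ b ℤ.^ n
  ^-cong zero    a≈b = ≈-refl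
  ^-cong (suc n) a≈b = *-cong a≈b (^-cong n a≈b)

  ∑-cong≈ : ∀ n {f g : ℕ → ℤ} → (∀ k → k ℕ.< n → f k ≈ g k) → ∑ n f ≈ ∑ n g
  ∑-cong≈ zero    f≈g = ≈-refl
  ∑-cong≈ (suc n) f≈g = +-cong (f≈g 0 (s≤s z≤n)) (∑-cong≈ n (λ k k<n → f≈g (suc k) (s≤s k<n)))

  ≈0⇒∣ : ∀ {a} → a ≈ + 0 → m ℕ.∣ ∣ a ∣
  ≈0⇒∣ {a} (mod∣ m∣a-0) = ∣⇒∣ᵤ (subst (+ m ∣_) (ℤ.+-identityʳ a) m∣a-0)

  ∣⇒≈0 : ∀ {a} → m ℕ.∣ ∣ a ∣ → a ≈ + 0
  ∣⇒≈0 {a} m∣a = via (sym (ℤ.+-identityʳ a)) (∣ᵤ⇒∣ m∣a)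

  a≈b⇒a-b≈0 : ∀ {a b} → a ≈ b → a - b ≈ + 0
  a≈b⇒a-b≈0 {a} {b} (mod∣ m∣a-b) = via (sym (ℤ.+-identityʳ (a - b))) m∣a-b

  a-b≈0⇒a≈b : ∀ {a b} → a - b ≈ + 0 → a ≈ b
  a-b≈0⇒a≈b {a} {b} (mod∣ m∣a-b-0) = via (ℤ.+-identityʳ (a - b)) m∣a-b-0

  infix 4 _≈?_
  _≈?_ : ∀ a b → Dec (a ≈ b)
  a ≈? b with m ℕ.∣? ∣ a - b ∣
  ... | yes m∣a-b = yes (a-b≈0⇒a≈b (∣⇒≈0 m∣a-b))
  ... | no  m∤a-b = no (λ a≈b → m∤a-b (≈0⇒∣ (a≈b⇒a-b≈0 a≈b)))

  ≈-% : ∀ a .{{_ : NonZero m}} → + a ≈ + (a % m)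
  ≈-% a = mod∣ (divides (+ (a / m)) (begin
    + a - + (a % m)                         ≡⟨ cong (λ x → + x - + (a % m)) (m≡m%n+[m/n]*n a m) ⟩
    + (a % m ℕ.+ a / m ℕ.* m) - + (a % m)   ≡⟨ cong (_- + (a % m)) (trans (ℤ.pos-+ (a % m) _) (cong (_+_ (+ (a % m))) (ℤ.pos-* (a / m) m))) ⟩
    (+ (a % m) + + (a / m) * + m) - + (a % m) ≡⟨ cancel (+ (a % m)) (+ (a / m) * + m) ⟩
    + (a / m) * + m ∎))
    where
    open ≡-Reasoning
    cancel : ∀ r x → (r + x) - r ≡ x
    cancel = solve-∀

  m*x≈0 : ∀ x → + m * x ≈ + 0
  m*x≈0 x = via (sym (ℤ.+-identityʳ (+ m * x))) (divides x (ℤ.*-comm (+ m) x))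

-- Finite differences

Δ^ : ℕ → (ℕ → ℤ) → ℕ → ℤ
Δ^ zero    f x = f x
Δ^ (suc d) f x = Δ^ d f x - Δ^ d f (suc x)

Δ^-cong : ∀ d {f g : ℕ → ℤ} → (∀ y → f y ≡ g y) → ∀ x → Δ^ d f x ≡ Δ^ d g x
Δ^-cong zero    f≡g x = f≡g x
Δ^-cong (suc d) f≡g x = cong₂ _-_ (Δ^-cong d f≡g x) (Δ^-cong d f≡g (suc x))

Δ^-- : ∀ d (f g : ℕ → ℤ) x → Δ^ d (λ y → f y - g y) x ≡ Δ^ d f x - Δ^ d g x
Δ^-- zero    f g x = refl
Δ^-- (suc d) f g x =
  trans (cong₂ _-_ (Δ^-- d f g x) (Δ^-- d f g (suc x))) (interchange (Δ^ d f x) (Δ^ d g x) _ _)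
  where
  interchange : ∀ a b c d → (a - b) - (c - d) ≡ (a - c) - (b - d)
  interchange = solve-∀

Δ^-shift : ∀ d (f : ℕ → ℤ) x → Δ^ d (f ∘ suc) x ≡ Δ^ d f (suc x)
Δ^-shift zero    f x = refl
Δ^-shift (suc d) f x = cong₂ _-_ (Δ^-shift d f x) (Δ^-shift d f (suc x))

Δ^-suc : ∀ d (f : ℕ → ℤ) x → Δ^ (suc d) f x ≡ Δ^ d (λ y → f y - f (suc y)) x
Δ^-suc zero    f x = refl
Δ^-suc (suc d) f x = cong₂ _-_ (Δ^-suc d f x) (Δ^-suc d f (suc x))

Δ^-binomialSum : ∀ m f x → Δ^ m f x ≡ binomialSum m (λ k → -1^ k * f (x ℕ.+ k))
Δ^-binomialSum zero    f x =
  sym (trans (ℤ.+-identityʳ _) (trans (ℤ.*-identityˡ _) (trans (ℤ.*-identityˡ _) (cong f (ℕ.+-identityʳ x)))))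
Δ^-binomialSum (suc m) f x = begin
  Δ^ m f x - Δ^ m f (suc x)
    ≡⟨ cong₂ _-_ (Δ^-binomialSum m f x) (Δ^-binomialSum m f (suc x)) ⟩
  binomialSum m g - binomialSum m (λ k → -1^ k * f (suc x ℕ.+ k))
    ≡⟨ cong (_+_ (binomialSum m g)) (binomialSum-neg m (λ k → -1^ k * f (suc x ℕ.+ k))) ⟨
  binomialSum m g + binomialSum m (λ k → - (-1^ k * f (suc x ℕ.+ k)))
    ≡⟨ cong (_+_ (binomialSum m g)) (binomialSum-cong m shifted) ⟩
  binomialSum m g + binomialSum m (g ∘ suc)
    ≡⟨ binomialSum-suc m g ⟨
  binomialSum (suc m) g ∎
  where
  open ≡-Reasoning
  g : ℕ → ℤ
  g k = -1^ k * f (x ℕ.+ k)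
  neg-* : ∀ a b → - (a * b) ≡ (- + 1 * a) * b
  neg-* = solve-∀
  shifted : ∀ k → - (-1^ k * f (suc x ℕ.+ k)) ≡ g (suc k)
  shifted k = trans (cong (λ y → - (-1^ k * f y)) (sym (ℕ.+-suc x k))) (neg-* (-1^ k) _)

record DegreeBelow (d : ℕ) (f : ℕ → ℤ) : Set where
  constructor degreeBelow
  field Δ^≡0 : ∀ x → Δ^ d f x ≡ + 0

DegreeBelow-suc : ∀ {d f} → DegreeBelow d f → DegreeBelow (suc d) f
DegreeBelow-suc (degreeBelow f<d) = degreeBelow λ x → cong₂ _-_ (f<d x) (f<d (suc x))

DegreeBelow-≤ : ∀ {d e f} → d ℕ.≤ e → DegreeBelow d f → DegreeBelow e f
DegreeBelow-≤ {d} {e} {f} d≤e f<d = subst (λ n → DegreeBelow n f) (ℕ.m∸n+n≡m d≤e) (lift (e ℕ.∸ d))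
  where
  lift : ∀ b → DegreeBelow (b ℕ.+ d) f
  lift zero    = f<d
  lift (suc b) = DegreeBelow-suc (lift b)

DegreeBelow-cong : ∀ {d} {f g : ℕ → ℤ} → (∀ y → f y ≡ g y) → DegreeBelow d f → DegreeBelow d g
DegreeBelow-cong {d} f≡g (degreeBelow f<d) = degreeBelow λ x → trans (sym (Δ^-cong d f≡g x)) (f<d x)

DegreeBelow-- : ∀ {d f g} → DegreeBelow d f → DegreeBelow d g → DegreeBelow d (λ y → f y - g y)
DegreeBelow-- {d} {f} {g} (degreeBelow f<d) (degreeBelow g<d) =
  degreeBelow λ x → trans (Δ^-- d f g x) (cong₂ _-_ (f<d x) (g<d x))

DegreeBelow-shift : ∀ {d f} → DegreeBelow d f → DegreeBelow d (f ∘ suc)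
DegreeBelow-shift {d} {f} (degreeBelow f<d) = degreeBelow λ x → trans (Δ^-shift d f x) (f<d (suc x))

DegreeBelow-Δ : ∀ {d f} → DegreeBelow (suc d) f → DegreeBelow d (λ y → f y - f (suc y))
DegreeBelow-Δ {d} {f} (degreeBelow f<d+1) = degreeBelow λ x → trans (sym (Δ^-suc d f x)) (f<d+1 x)

DegreeBelow-*id : ∀ {d h} → DegreeBelow d h → DegreeBelow (suc d) (λ k → + k * h k)
DegreeBelow-*id {zero} {h} (degreeBelow h<0) = degreeBelow λ x →
  cong₂ _-_ (trans (cong (_*_ (+ x)) (h<0 x)) (ℤ.*-zeroʳ (+ x)))
            (trans (cong (_*_ (+ suc x)) (h<0 (suc x))) (ℤ.*-zeroʳ (+ suc x)))
DegreeBelow-*id {suc d} {h} h<d+1 = degreeBelow λ x →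
  trans (Δ^-suc (suc d) (λ k → + k * h k) x) (DegreeBelow.Δ^≡0 Δ[id*h]<d+1 x)
  where
  leibniz : ∀ y → + y * (h y - h (suc y)) - h (suc y) ≡ + y * h y - + suc y * h (suc y)
  leibniz y = trans (regroup (+ y) (h y) (h (suc y))) (cong (λ z → + y * h y - z * h (suc y)) (ℤ.+-comm (+ y) (+ 1)))
    where
    regroup : ∀ a b c → a * (b - c) - c ≡ a * b - (a + + 1) * c
    regroup = solve-∀
  Δ[id*h]<d+1 : DegreeBelow (suc d) (λ y → + y * h y - + suc y * h (suc y))
  Δ[id*h]<d+1 = DegreeBelow-cong leibniz (DegreeBelow-- (DegreeBelow-*id (DegreeBelow-Δ h<d+1)) (DegreeBelow-shift h<d+1))

DegreeBelow-^ : ∀ n → DegreeBelow (suc n) (λ k → (+ k) ℤ.^ n)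
DegreeBelow-^ zero    = degreeBelow λ x → refl
DegreeBelow-^ (suc n) = DegreeBelow-*id (DegreeBelow-^ n)

module PrimeModulus (q : ℕ) (prime : Prime (suc q)) where

  p : ℕ
  p = suc q

  open Congruence p public
  open SetoidReasoning ≈-setoid

  *≈0⇒ : ∀ {a b} → a * b ≈ + 0 → a ≈ + 0 ⊎ b ≈ + 0
  *≈0⇒ {a} {b} ab≈0 with euclidsLemma ∣ a ∣ ∣ b ∣ prime (subst (p ℕ.∣_) (ℤ.abs-* a b) (≈0⇒∣ ab≈0))
  ... | inj₁ p∣a = inj₁ (∣⇒≈0 p∣a)
  ... | inj₂ p∣b = inj₂ (∣⇒≈0 p∣b)

  0<k<p⇒p∤k : ∀ {k} → 0 ℕ.< k → k ℕ.< p → ¬ (p ℕ.∣ k)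
  0<k<p⇒p∤k {suc k} _ k<p p∣k = ℕ.<⇒≱ k<p (ℕ.∣⇒≤ p∣k)

  0<k<p⇒k≉0 : ∀ {k} → 0 ℕ.< k → k ℕ.< p → ¬ (+ k ≈ + 0)
  0<k<p⇒k≉0 0<k k<p k≈0 = 0<k<p⇒p∤k 0<k k<p (≈0⇒∣ k≈0)

  pCk≈0 : ∀ {k} → 0 ℕ.< k → k ℕ.< p → + (p C k) ≈ + 0
  pCk≈0 {suc k} _ k<p with euclidsLemma (suc k) (p C suc k) prime (ℕ.divides (q C k) k*pCk≡qCk*p)
    where
    k*pCk≡qCk*p : suc k ℕ.* (p C suc k) ≡ (q C k) ℕ.* p
    k*pCk≡qCk*p = trans ([k+1]*[n+1]C[k+1]≡[n+1]*nCk q k) (ℕ.*-comm p (q C k))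
  ... | inj₁ p∣k   = contradiction p∣k (0<k<p⇒p∤k (s≤s z≤n) k<p)
  ... | inj₂ p∣pCk = ∣⇒≈0 p∣pCk

  binomialSum-p≈first+last : ∀ (g : ℕ → ℤ) → binomialSum p g ≈ g 0 + g p
  binomialSum-p≈first+last g = begin
    + 1 * g 0 + ∑ p middle                           ≈⟨ +-cong (≈-reflexive (ℤ.*-identityˡ (g 0))) (≈-reflexive (∑-init-last q middle)) ⟩
    g 0 + (∑ q middle + + (p C p) * g p)             ≈⟨ +-cong (≈-refl {g 0}) (+-cong (∑-cong≈ q middle≈0) (≈-reflexive (cong (λ c → + c * g p) (nCn≡1 p)))) ⟩
    g 0 + (∑[ k < q ] (+ 0) + + 1 * g p)             ≡⟨ cong₂ (λ s t → g 0 + (s + t)) (∑-zero q) (ℤ.*-identityˡ (g p)) ⟩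
    g 0 + (+ 0 + g p)                                ≡⟨ cong (_+_ (g 0)) (ℤ.+-identityˡ (g p)) ⟩
    g 0 + g p                                        ∎
    where
    middle : ℕ → ℤ
    middle k = + (p C suc k) * g (suc k)
    middle≈0 : ∀ k → k ℕ.< q → middle k ≈ + 0
    middle≈0 k k<q = begin
      + (p C suc k) * g (suc k) ≈⟨ *-cong (pCk≈0 (s≤s z≤n) (s≤s k<q)) (≈-refl {g (suc k)}) ⟩
      + 0 * g (suc k)           ≡⟨ ℤ.*-zeroˡ (g (suc k)) ⟩
      + 0                       ∎

  fermat : ∀ a → (+ a) ℤ.^ p ≈ + a
  fermat zero    = ≈-reflexive (ℤ.*-zeroˡ ((+ 0) ℤ.^ q))
  fermat (suc a) = begin
    (+ 1 + + a) ℤ.^ p             ≡⟨ 1+a^n≡binomialSum p (+ a) ⟩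
    binomialSum p (ℤ._^_ (+ a))   ≈⟨ binomialSum-p≈first+last (ℤ._^_ (+ a)) ⟩
    + 1 + (+ a) ℤ.^ p             ≈⟨ +-cong (≈-refl {+ 1}) (fermat a) ⟩
    + 1 + + a                     ∎

  fermat-unit : ∀ a → ¬ (+ a ≈ + 0) → (+ a) ℤ.^ q ≈ + 1
  fermat-unit a a≉0 with *≈0⇒ a[a^q-1]≈0
    where
    factor : ∀ x y → x * (y - + 1) ≡ x * y - x
    factor = solve-∀
    a[a^q-1]≈0 : + a * ((+ a) ℤ.^ q - + 1) ≈ + 0
    a[a^q-1]≈0 = ≈-trans (≈-reflexive (factor (+ a) ((+ a) ℤ.^ q))) (a≈b⇒a-b≈0 (fermat a))
  ... | inj₁ a≈0       = contradiction a≈0 a≉0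
  ... | inj₂ a^q-1≈0 = a-b≈0⇒a≈b a^q-1≈0

  qCk≈-1^k : ∀ k → k ℕ.≤ q → + (q C k) ≈ -1^ k
  qCk≈-1^k zero    _   = ≈-refl
  qCk≈-1^k (suc k) k<q = begin
    + (q C suc k)          ≈⟨ a-b≈0⇒a≈b (≈-trans (≈-reflexive (rearrange (+ (q C k)) (+ (q C suc k)))) pascal≈0) ⟩
    - + (q C k)            ≈⟨ neg-cong (qCk≈-1^k k (ℕ.<⇒≤ k<q)) ⟩
    - -1^ k                ≡⟨ -1^-suc k ⟨
    -1^ (suc k)            ∎
    where
    rearrange : ∀ a b → b - - a ≡ a + b
    rearrange = solve-∀
    pascal≈0 : + (q C k) + + (q C suc k) ≈ + 0
    pascal≈0 = subst (_≈ + 0) (ℤ.pos-+ (q C k) (q C suc k))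
                 (subst (λ c → + c ≈ + 0) (sym (nCk+nC[k+1]≡[n+1]C[k+1] q k)) (pCk≈0 (s≤s z≤n) (s≤s k<q)))

  y²≈1∧y≉1⇒y≈-1 : ∀ y → y * y ≈ + 1 → ¬ (y ≈ + 1) → y ≈ - + 1
  y²≈1∧y≉1⇒y≈-1 y y²≈1 y≉1 with *≈0⇒ (≈-trans (≈-reflexive (difference-of-squares y)) (a≈b⇒a-b≈0 y²≈1))
    where
    difference-of-squares : ∀ y → (y - + 1) * (y - - + 1) ≡ y * y - + 1
    difference-of-squares = solve-∀
  ... | inj₁ y-1≈0 = contradiction (a-b≈0⇒a≈b y-1≈0) y≉1
  ... | inj₂ y+1≈0 = a-b≈0⇒a≈b y+1≈0

  powerSum≈0 : ∀ n → n ℕ.< q → ∑[ k < p ] ((+ k) ℤ.^ n) ≈ + 0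
  powerSum≈0 n n<q = begin
    ∑[ k < p ] ((+ k) ℤ.^ n)                        ≡⟨ ∑-cong p (λ k _ → insertSigns k) ⟩
    ∑[ k < p ] (-1^ k * (-1^ k * (+ k) ℤ.^ n))      ≈⟨ ∑-cong≈ p {g = λ k → + (q C k) * (-1^ k * (+ k) ℤ.^ n)} (λ k k<p → *-cong (≈-sym (qCk≈-1^k k (ℕ.≤-pred k<p))) ≈-refl) ⟩
    binomialSum q (λ k → -1^ k * (+ k) ℤ.^ n)       ≡⟨ Δ^-binomialSum q (λ k → (+ k) ℤ.^ n) 0 ⟨
    Δ^ q (λ k → (+ k) ℤ.^ n) 0                      ≡⟨ DegreeBelow.Δ^≡0 (DegreeBelow-≤ n<q (DegreeBelow-^ n)) 0 ⟩
    + 0                                             ∎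
    where
    insertSigns : ∀ k → (+ k) ℤ.^ n ≡ -1^ k * (-1^ k * (+ k) ℤ.^ n)
    insertSigns k = sym (trans (sym (ℤ.*-assoc (-1^ k) (-1^ k) _))
                               (trans (cong (_* (+ k) ℤ.^ n) (-1^k*-1^k≡1 k)) (ℤ.*-identityˡ _)))

-- Powers of 1 + i

-- (1 + i)ᵐ = re m + i · im m
re im : ℕ → ℤ
re zero    = + 1
re (suc m) = re m - im m
im zero    = + 0
im (suc m) = re m + im m

-- iᵏ = Re-i^ k + i · Im-i^ k
Re-i^ Im-i^ : ℕ → ℤ
Re-i^ zero          = + 1
Re-i^ (suc zero)    = + 0
Re-i^ (suc (suc k)) = - Re-i^ k
Im-i^ zero          = + 0
Im-i^ (suc zero)    = + 1
Im-i^ (suc (suc k)) = - Im-i^ k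

Im-i^-suc : ∀ k → Im-i^ (suc k) ≡ Re-i^ k
Re-i^-suc : ∀ k → Re-i^ (suc k) ≡ - Im-i^ k
Im-i^-suc zero    = refl
Im-i^-suc (suc k) = sym (Re-i^-suc k)
Re-i^-suc zero    = refl
Re-i^-suc (suc k) = cong -_ (sym (Im-i^-suc k))

Im-i^-even : ∀ j → Im-i^ (2 ℕ.* j) ≡ + 0
Im-i^-even zero    = refl
Im-i^-even (suc j) rewrite ℕ.+-suc j (j ℕ.+ 0) = cong -_ (Im-i^-even j)

Im-i^-odd : ∀ j → Im-i^ (suc (2 ℕ.* j)) ≡ -1^ j
Im-i^-odd zero    = refl
Im-i^-odd (suc j) rewrite ℕ.+-suc j (j ℕ.+ 0) = trans (cong -_ (Im-i^-odd j)) (sym (-1^-suc j))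

im≡binomialSum : ∀ m → im m ≡ binomialSum m Im-i^
re≡binomialSum : ∀ m → re m ≡ binomialSum m Re-i^
im≡binomialSum zero    = refl
im≡binomialSum (suc m) = begin
  re m + im m                                              ≡⟨ cong₂ _+_ (re≡binomialSum m) (im≡binomialSum m) ⟩
  binomialSum m Re-i^ + binomialSum m Im-i^                ≡⟨ ℤ.+-comm (binomialSum m Re-i^) _ ⟩
  binomialSum m Im-i^ + binomialSum m Re-i^                ≡⟨ cong (_+_ (binomialSum m Im-i^)) (binomialSum-cong m Im-i^-suc) ⟨
  binomialSum m Im-i^ + binomialSum m (Im-i^ ∘ suc)        ≡⟨ binomialSum-suc m Im-i^ ⟨
  binomialSum (suc m) Im-i^                                ∎
  where open ≡-Reasoning
re≡binomialSum zero    = refl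
re≡binomialSum (suc m) = begin
  re m - im m                                              ≡⟨ cong₂ _-_ (re≡binomialSum m) (im≡binomialSum m) ⟩
  binomialSum m Re-i^ - binomialSum m Im-i^                ≡⟨ cong (_+_ (binomialSum m Re-i^)) (binomialSum-neg m Im-i^) ⟨
  binomialSum m Re-i^ + binomialSum m (λ k → - Im-i^ k)    ≡⟨ cong (_+_ (binomialSum m Re-i^)) (binomialSum-cong m Re-i^-suc) ⟨
  binomialSum m Re-i^ + binomialSum m (Re-i^ ∘ suc)        ≡⟨ binomialSum-suc m Re-i^ ⟨
  binomialSum (suc m) Re-i^                                ∎
  where open ≡-Reasoning

-- The step j ↦ j + 1 multiplies by (1 + i)² = 2i.
odd-power-squares : ∀ j → im (suc (j ℕ.+ j)) * im (suc (j ℕ.+ j)) ≡ (+ 2) ℤ.^ (j ℕ.+ j)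
              × re (suc (j ℕ.+ j)) * re (suc (j ℕ.+ j)) ≡ (+ 2) ℤ.^ (j ℕ.+ j)
odd-power-squares zero    = refl , refl
odd-power-squares (suc j) rewrite ℕ.+-suc j j with odd-power-squares j
... | im² , re² = trans (times-2i-im (re m) (im m)) (trans (cong (_*_ (+ 4)) re²) (four ((+ 2) ℤ.^ (j ℕ.+ j))))
                , trans (times-2i-re (re m) (im m)) (trans (cong (_*_ (+ 4)) im²) (four ((+ 2) ℤ.^ (j ℕ.+ j))))
  where
  m = suc (j ℕ.+ j)
  times-2i-im : ∀ a b → ((a - b) + (a + b)) * ((a - b) + (a + b)) ≡ + 4 * (a * a)
  times-2i-im = solve-∀
  times-2i-re : ∀ a b → ((a - b) - (a + b)) * ((a - b) - (a + b)) ≡ + 4 * (b * b)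
  times-2i-re = solve-∀
  four : ∀ x → + 4 * x ≡ + 2 * (+ 2 * x)
  four = solve-∀

0^n≡0 : ∀ n .{{_ : NonZero n}} → (+ 0) ℤ.^ n ≡ + 0
0^n≡0 (suc n) = refl

legendre-residue : ∀ a p → ¬ (p ℕ.∣ ∣ a ∣) → Any (λ x → p ℕ.∣ ∣ + x * + x - a ∣) (upTo p) → legendre a p ≡ + 1
legendre-residue a p p∤a root with p ℕ.∣? ∣ a ∣
... | yes p∣a = contradiction p∣a p∤a
... | no _ with any? (λ x → p ℕ.∣? ∣ + x * + x - a ∣) (upTo p)
...   | yes _     = refl
...   | no noRoot = contradiction root noRoot

legendre-nonresidue : ∀ a p → ¬ (p ℕ.∣ ∣ a ∣) → (∀ x → ¬ (p ℕ.∣ ∣ + x * + x - a ∣)) → legendre a p ≡ - + 1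
legendre-nonresidue a p p∤a noRoot with p ℕ.∣? ∣ a ∣
... | yes p∣a = contradiction p∣a p∤a
... | no _ with any? (λ x → p ℕ.∣? ∣ + x * + x - a ∣) (upTo p)
...   | yes root = contradiction (proj₂ (satisfied root)) (noRoot (proj₁ (satisfied root)))
...   | no _     = refl

even-or-odd : ∀ n → ∃ λ m → n ≡ m ℕ.+ m ⊎ n ≡ suc (m ℕ.+ m)
even-or-odd zero    = 0 , inj₁ refl
even-or-odd (suc n) with even-or-odd n
... | m , inj₁ n≡2m   = m , inj₂ (cong suc n≡2m)
... | m , inj₂ n≡2m+1 = suc m , inj₁ (cong suc (trans n≡2m+1 (sym (ℕ.+-suc m m))))


module OddPrime (n : ℕ) .{{_ : NonZero n}} (prime : Prime (suc (n ℕ.+ n))) where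
  open PrimeModulus (n ℕ.+ n) prime

  q : ℕ
  q = n ℕ.+ n

  0<n : 0 ℕ.< n
  0<n = ℕ.>-nonZero⁻¹ n

  n<q : n ℕ.< q
  n<q = ℕ.m<m+n n 0<n

  n+n≡2*n : n ℕ.+ n ≡ 2 ℕ.* n
  n+n≡2*n = cong (n ℕ.+_) (sym (ℕ.+-identityʳ n))

  2<p : 2 ℕ.< p
  2<p = s≤s (ℕ.+-mono-≤ 0<n 0<n)

  1≉0 : ¬ (+ 1 ≈ + 0)
  1≉0 = 0<k<p⇒k≉0 (s≤s z≤n) (ℕ.<-trans (ℕ.n<1+n 1) 2<p)

  2≉0 : ¬ (+ 2 ≈ + 0)
  2≉0 = 0<k<p⇒k≉0 (s≤s z≤n) 2<p

  x^n≈-1 : ∃ λ x → (+ x) ℤ.^ n ≈ - + 1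
  x^n≈-1 with ℕ.anyUpTo? (λ k → ¬? ((+ suc k) ℤ.^ n ≈? + 1)) q
  ... | yes (k , k<q , [k+1]^n≉1) = suc k , y²≈1∧y≉1⇒y≈-1 _ square≈1 [k+1]^n≉1
    where
    square≈1 : (+ suc k) ℤ.^ n * (+ suc k) ℤ.^ n ≈ + 1
    square≈1 = ≈-trans (≈-reflexive (sym (ℤ.^-distribˡ-+-* (+ suc k) n n)))
                       (fermat-unit (suc k) (0<k<p⇒k≉0 (s≤s z≤n) (s≤s k<q)))
  ... | no ∄ = contradiction q≈0 (0<k<p⇒k≉0 (ℕ.<-trans 0<n n<q) (ℕ.n<1+n q))
    where
    open SetoidReasoning ≈-setoid
    all≈1 : ∀ k → k ℕ.< q → (+ suc k) ℤ.^ n ≈ + 1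
    all≈1 k k<q = decidable-stable ((+ suc k) ℤ.^ n ≈? + 1) (λ ≉1 → ∄ (k , k<q , ≉1))
    q≈0 : + q ≈ + 0
    q≈0 = begin
      + q                                  ≡⟨ ∑-const q ⟨
      ∑[ k < q ] (+ 1)                     ≈⟨ ∑-cong≈ q (λ k k<q → ≈-sym (all≈1 k k<q)) ⟩
      ∑[ k < q ] ((+ suc k) ℤ.^ n)         ≡⟨ ℤ.+-identityˡ _ ⟨
      + 0 + ∑[ k < q ] ((+ suc k) ℤ.^ n)   ≡⟨ cong (_+ ∑[ k < q ] ((+ suc k) ℤ.^ n)) (0^n≡0 n) ⟨
      ∑[ k < p ] ((+ k) ℤ.^ n)             ≈⟨ powerSum≈0 n n<q ⟩
      + 0                                  ∎

  p∤-1 : ¬ (p ℕ.∣ ∣ - + 1 ∣)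
  p∤-1 p∣1 = 1≉0 (∣⇒≈0 p∣1)

  -1-residue : ∀ {m} → n ≡ m ℕ.+ m → Any (λ x → p ℕ.∣ ∣ + x * + x - - + 1 ∣) (upTo p)
  -1-residue {m} n≡m+m = Any.map (λ { refl → w²≈-1 }) (∈-upTo⁺ (m%n<n (x ℕ.^ m) p))
    where
    open SetoidReasoning ≈-setoid
    x = proj₁ x^n≈-1
    w = x ℕ.^ m % p
    w≈x^m : + w ≈ (+ x) ℤ.^ m
    w≈x^m = ≈-trans (≈-sym (≈-% (x ℕ.^ m))) (≈-reflexive (pos-^ x m))
    w²≈-1 : p ℕ.∣ ∣ + w * + w - - + 1 ∣
    w²≈-1 = ≈0⇒∣ (a≈b⇒a-b≈0 (begin
      + w * + w                  ≈⟨ *-cong w≈x^m w≈x^m ⟩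
      (+ x) ℤ.^ m * (+ x) ℤ.^ m  ≡⟨ ℤ.^-distribˡ-+-* (+ x) m m ⟨
      (+ x) ℤ.^ (m ℕ.+ m)        ≡⟨ cong ((+ x) ℤ.^_) n≡m+m ⟨
      (+ x) ℤ.^ n                ≈⟨ proj₂ x^n≈-1 ⟩
      - + 1                      ∎))

  -1-nonresidue : ∀ {m} → n ≡ suc (m ℕ.+ m) → ∀ x → ¬ (p ℕ.∣ ∣ + x * + x - - + 1 ∣)
  -1-nonresidue {m} n≡2m+1 x x²+1≈0 = 2≉0 (a≈b⇒a-b≈0 1≈-1)
    where
    open SetoidReasoning ≈-setoid
    x²≈-1 : + x * + x ≈ - + 1
    x²≈-1 = a-b≈0⇒a≈b (∣⇒≈0 x²+1≈0)
    x≉0 : ¬ (+ x ≈ + 0)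
    x≉0 x≈0 = 1≉0 (neg-cong (≈-trans (≈-sym x²≈-1) (*-cong x≈0 x≈0)))
    1≈-1 : + 1 ≈ - + 1
    1≈-1 = begin
      + 1                    ≈⟨ fermat-unit x x≉0 ⟨
      (+ x) ℤ.^ (n ℕ.+ n)    ≡⟨ i^[n+n]≡[i*i]^n (+ x) n ⟩
      (+ x * + x) ℤ.^ n      ≈⟨ ^-cong n x²≈-1 ⟩
      -1^ n                  ≡⟨ cong -1^ n≡2m+1 ⟩
      -1^ (suc (m ℕ.+ m))    ≡⟨ -1^-suc (m ℕ.+ m) ⟩
      - -1^ (m ℕ.+ m)        ≡⟨ cong -_ (-1^[k+k]≡1 m) ⟩
      - + 1                  ∎

  legendre-1 : legendre (- + 1) p ≡ -1^ n
  legendre-1 with even-or-odd n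
  ... | m , inj₁ n≡m+m  = begin
    legendre (- + 1) p   ≡⟨ legendre-residue (- + 1) p p∤-1 (-1-residue {m} n≡m+m) ⟩
    + 1                  ≡⟨ -1^[k+k]≡1 m ⟨
    -1^ (m ℕ.+ m)        ≡⟨ cong -1^ n≡m+m ⟨
    -1^ n                ∎
    where open ≡-Reasoning
  ... | m , inj₂ n≡2m+1 = begin
    legendre (- + 1) p   ≡⟨ legendre-nonresidue (- + 1) p p∤-1 (-1-nonresidue {m} n≡2m+1) ⟩
    - + 1                ≡⟨ cong -_ (-1^[k+k]≡1 m) ⟨
    - -1^ (m ℕ.+ m)      ≡⟨ -1^-suc (m ℕ.+ m) ⟨
    -1^ (suc (m ℕ.+ m))  ≡⟨ cong -1^ n≡2m+1 ⟨
    -1^ n                ∎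
    where open ≡-Reasoning

  M : ℕ → ℕ
  M k = (p C k) / p

  pCk≡M*p : ∀ {k} → 0 ℕ.< k → k ℕ.< p → p C k ≡ M k ℕ.* p
  pCk≡M*p {k} 0<k k<p = sym (m/n*n≡m {p C k} {p} (≈0⇒∣ (pCk≈0 0<k k<p)))

  [k+1]*M[k+1]≡qCk : ∀ {k} → k ℕ.< q → suc k ℕ.* M (suc k) ≡ q C k
  [k+1]*M[k+1]≡qCk {k} k<q = ℕ.*-cancelʳ-≡ _ _ p (begin
    suc k ℕ.* M (suc k) ℕ.* p   ≡⟨ ℕ.*-assoc (suc k) (M (suc k)) p ⟩
    suc k ℕ.* (M (suc k) ℕ.* p) ≡⟨ cong (suc k ℕ.*_) (pCk≡M*p (s≤s z≤n) (s≤s k<q)) ⟨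
    suc k ℕ.* (p C suc k)       ≡⟨ [k+1]*[n+1]C[k+1]≡[n+1]*nCk q k ⟩
    p ℕ.* (q C k)               ≡⟨ ℕ.*-comm p (q C k) ⟩
    (q C k) ℕ.* p               ∎)
    where open ≡-Reasoning

  [2j+1]*M[2j+1]≈1 : ∀ {j} → j ℕ.< n → + suc (2 ℕ.* j) * + M (suc (2 ℕ.* j)) ≈ + 1
  [2j+1]*M[2j+1]≈1 {j} j<n = begin
    + suc (2 ℕ.* j) * + M (suc (2 ℕ.* j))    ≡⟨ ℤ.pos-* (suc (2 ℕ.* j)) _ ⟨
    + (suc (2 ℕ.* j) ℕ.* M (suc (2 ℕ.* j)))  ≡⟨ cong +_ ([k+1]*M[k+1]≡qCk 2j<q) ⟩
    + (q C (2 ℕ.* j))                        ≈⟨ qCk≈-1^k (2 ℕ.* j) (ℕ.<⇒≤ 2j<q) ⟩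
    -1^ (2 ℕ.* j)                            ≡⟨ cong -1^ (cong (j ℕ.+_) (ℕ.+-identityʳ j)) ⟩
    -1^ (j ℕ.+ j)                            ≡⟨ -1^[k+k]≡1 j ⟩
    + 1                                      ∎
    where
    open SetoidReasoning ≈-setoid
    2j<q : 2 ℕ.* j ℕ.< q
    2j<q = subst (2 ℕ.* j ℕ.<_) (sym n+n≡2*n) (ℕ.*-monoʳ-< 2 j<n)

  B : ℤ
  B = ∑[ j < n ] (-1^ j * + M (suc (2 ℕ.* j)))

  middleTerms≡p*B : ∑[ k < q ] (+ (p C suc k) * Im-i^ (suc k)) ≡ + p * B
  middleTerms≡p*B = begin
    ∑[ k < q ] (+ (p C suc k) * Im-i^ (suc k))          ≡⟨ ∑-cong q factor-p ⟩
    ∑[ k < q ] (+ p * g k)                              ≡⟨ ∑-*ˡ q (+ p) g ⟩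
    + p * ∑ q g                                         ≡⟨ cong (λ m → + p * ∑ m g) n+n≡2*n ⟩
    + p * ∑ (2 ℕ.* n) g                                 ≡⟨ cong (_*_ (+ p)) (∑-even-odd n g) ⟩
    + p * ∑[ j < n ] (g (2 ℕ.* j) + g (suc (2 ℕ.* j)))  ≡⟨ cong (_*_ (+ p)) (∑-cong n (λ j _ → odd-only j)) ⟩
    + p * B                                             ∎
    where
    open ≡-Reasoning
    g : ℕ → ℤ
    g k = Im-i^ (suc k) * + M (suc k)
    factor-p : ∀ k → k ℕ.< q → + (p C suc k) * Im-i^ (suc k) ≡ + p * g k
    factor-p k k<q = begin
      + (p C suc k) * Im-i^ (suc k)        ≡⟨ cong (λ c → + c * Im-i^ (suc k)) (pCk≡M*p (s≤s z≤n) (s≤s k<q)) ⟩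
      + (M (suc k) ℕ.* p) * Im-i^ (suc k)  ≡⟨ cong (_* Im-i^ (suc k)) (ℤ.pos-* (M (suc k)) p) ⟩
      + M (suc k) * + p * Im-i^ (suc k)    ≡⟨ rearrange (+ M (suc k)) (+ p) (Im-i^ (suc k)) ⟩
      + p * g k                            ∎
      where
      rearrange : ∀ a b c → a * b * c ≡ b * (c * a)
      rearrange = solve-∀
    odd-only : ∀ j → g (2 ℕ.* j) + g (suc (2 ℕ.* j)) ≡ -1^ j * + M (suc (2 ℕ.* j))
    odd-only j = begin
      g (2 ℕ.* j) + - Im-i^ (2 ℕ.* j) * + M (suc (suc (2 ℕ.* j)))
        ≡⟨ cong (λ x → g (2 ℕ.* j) + - x * + M (suc (suc (2 ℕ.* j)))) (Im-i^-even j) ⟩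
      g (2 ℕ.* j) + + 0                    ≡⟨ ℤ.+-identityʳ (g (2 ℕ.* j)) ⟩
      g (2 ℕ.* j)                          ≡⟨ cong (_* + M (suc (2 ℕ.* j))) (Im-i^-odd j) ⟩
      -1^ j * + M (suc (2 ℕ.* j))          ∎

  im-p≡-1^n+p*B : im p ≡ -1^ n + + p * B
  im-p≡-1^n+p*B = begin
    im p                                                     ≡⟨ im≡binomialSum p ⟩
    + 1 * + 0 + ∑[ k < p ] (+ (p C suc k) * Im-i^ (suc k))   ≡⟨ ℤ.+-identityˡ _ ⟩
    ∑[ k < p ] (+ (p C suc k) * Im-i^ (suc k))               ≡⟨ ∑-init-last q (λ k → + (p C suc k) * Im-i^ (suc k)) ⟩
    ∑[ k < q ] (+ (p C suc k) * Im-i^ (suc k)) + + (p C p) * Im-i^ p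
      ≡⟨ cong₂ _+_ middleTerms≡p*B (cong (λ c → + c * Im-i^ p) (nCn≡1 p)) ⟩
    + p * B + + 1 * Im-i^ (suc (n ℕ.+ n))                    ≡⟨ cong (λ m → + p * B + + 1 * Im-i^ (suc m)) n+n≡2*n ⟩
    + p * B + + 1 * Im-i^ (suc (2 ℕ.* n))                    ≡⟨ cong (λ i → + p * B + + 1 * i) (Im-i^-odd n) ⟩
    + p * B + + 1 * -1^ n                                    ≡⟨ cong (_+_ (+ p * B)) (ℤ.*-identityˡ (-1^ n)) ⟩
    + p * B + -1^ n                                          ≡⟨ ℤ.+-comm (+ p * B) (-1^ n) ⟩
    -1^ n + + p * B                                          ∎
    where open ≡-Reasoning

  2^q-1≡p*B*[im-p+-1^n] : (+ 2) ℤ.^ q - + 1 ≡ + p * B * (im p + -1^ n)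
  2^q-1≡p*B*[im-p+-1^n] = begin
    (+ 2) ℤ.^ q - + 1                    ≡⟨ cong₂ _-_ (sym (proj₁ (odd-power-squares n))) (sym (-1^k*-1^k≡1 n)) ⟩
    im p * im p - χ * χ                  ≡⟨ cong (λ a → a * a - χ * χ) im-p≡-1^n+p*B ⟩
    (χ + + p * B) * (χ + + p * B) - χ * χ ≡⟨ factor χ (+ p) B ⟩
    + p * B * ((χ + + p * B) + χ)        ≡⟨ cong (λ a → + p * B * (a + χ)) im-p≡-1^n+p*B ⟨
    + p * B * (im p + χ)                 ∎
    where
    open ≡-Reasoning
    χ = -1^ n
    factor : ∀ c P B → (c + P * B) * (c + P * B) - c * c ≡ P * B * ((c + P * B) + c)
    factor = solve-∀

-- Congruences in ℤ₍ₚ₎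

fromℤ : ℤ → ℚᵘ
fromℤ a = mkℚᵘ a 0

fromℤ-+ : ∀ a b → fromℤ a ℚᵘ.+ fromℤ b ≃ fromℤ (a + b)
fromℤ-+ a b = *≡* (regroup a b)
  where
  regroup : ∀ a b → (a * + 1 + b * + 1) * + 1 ≡ (a + b) * + 1
  regroup = solve-∀

↧ₙ∣↧ₙ : ∀ (r : ℚ) w → toℚᵘ r ≃ w → ℚ.↧ₙ r ℕ.∣ ℚᵘ.↧ₙ w
↧ₙ∣↧ₙ (mkℚ n d-1 coprime) w (*≡* n*↧w≡↥w*d) =
  Coprimality.coprime-divisor (Coprimality.sym (Coprimality.recompute coprime)) (ℕ.divides ∣ ℚᵘ.↥ w ∣ eq)
  where
  eq : ∣ n ∣ ℕ.* ℚᵘ.↧ₙ w ≡ ∣ ℚᵘ.↥ w ∣ ℕ.* suc d-1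
  eq = trans (sym (ℤ.abs-* n (ℚᵘ.↧ w))) (trans (cong ∣_∣ n*↧w≡↥w*d) (ℤ.abs-* (ℚᵘ.↥ w) (+ suc d-1)))

module LocalCongruence (p : ℕ) (prime : Prime p) where
  open +-*-Solver

  PIntegralᵘ : ℚᵘ → Set
  PIntegralᵘ z = ¬ (p ℕ.∣ ℚᵘ.↧ₙ z)

  p̂ : ℚᵘ
  p̂ = fromℤ (+ p)

  infix 4 _∼_
  record _∼_ (x y : ℚᵘ) : Set where
    constructor p-multiple
    field
      cofactor            : ℚᵘ
      cofactor-integral   : PIntegralᵘ cofactor
      difference≃p*cofactor : x ℚᵘ.- y ≃ p̂ ℚᵘ.* cofactor

  p∤1 : ¬ (p ℕ.∣ 1)
  p∤1 p∣1 = ℕ.nonTrivial⇒≢1 {{prime⇒nonTrivial prime}} (ℕ.∣1⇒≡1 p∣1)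

  p∤*  : ∀ {a b} → ¬ (p ℕ.∣ a) → ¬ (p ℕ.∣ b) → ¬ (p ℕ.∣ a ℕ.* b)
  p∤* {a} {b} p∤a p∤b p∣ab with euclidsLemma a b prime p∣ab
  ... | inj₁ p∣a = p∤a p∣a
  ... | inj₂ p∣b = p∤b p∣b

  integral-+ : ∀ {a b} → PIntegralᵘ a → PIntegralᵘ b → PIntegralᵘ (a ℚᵘ.+ b)
  integral-+ {mkℚᵘ _ _} {mkℚᵘ _ _} = p∤*
  integral-* : ∀ {a b} → PIntegralᵘ a → PIntegralᵘ b → PIntegralᵘ (a ℚᵘ.* b)
  integral-* {mkℚᵘ _ _} {mkℚᵘ _ _} = p∤*
  integral-neg : ∀ {a} → PIntegralᵘ a → PIntegralᵘ (ℚᵘ.- a)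
  integral-neg {mkℚᵘ _ _} p∤↧a = p∤↧a

  ≃⇒∼ : ∀ {x y} → x ≃ y → x ∼ y
  ≃⇒∼ {x} {y} x≃y = p-multiple (fromℤ (+ 0)) p∤1 (begin
    x ℚᵘ.- y     ≈⟨ ℚᵘ.+-congˡ (ℚᵘ.- y) x≃y ⟩
    y ℚᵘ.- y     ≈⟨ ℚᵘ.+-inverseʳ y ⟩
    ℚᵘ.0ℚᵘ    ≈⟨ ℚᵘ.*-zeroʳ p̂ ⟨
    p̂ ℚᵘ.* fromℤ (+ 0) ∎)
    where open ℚᵘ.≃-Reasoning

  ∼-refl : ∀ {x} → x ∼ x
  ∼-refl = ≃⇒∼ ℚᵘ.≃-refl

  ∼-sym : ∀ {x y} → x ∼ y → y ∼ x
  ∼-sym {x} {y} (p-multiple z p∤z x-y≃p̂z) =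
    p-multiple (ℚᵘ.- z) (integral-neg {z} p∤z) (ℚᵘ.≃-trans (flip x y) (ℚᵘ.≃-trans (ℚᵘ.-‿cong x-y≃p̂z) (ℚᵘ.neg-distribʳ-* p̂ z)))
    where
    flip : ∀ x y → y ℚᵘ.- x ≃ ℚᵘ.- (x ℚᵘ.- y)
    flip = solve 2 (λ x y → y :- x := :- (x :- y)) ℚᵘ.≃-refl

  ∼-+ : ∀ {x y u v} → x ∼ y → u ∼ v → x ℚᵘ.+ u ∼ y ℚᵘ.+ v
  ∼-+ {x} {y} {u} {v} (p-multiple z p∤z x-y≃p̂z) (p-multiple w p∤w u-v≃p̂w) =
    p-multiple (z ℚᵘ.+ w) (integral-+ {z} {w} p∤z p∤w)
      (ℚᵘ.≃-trans (regroup x y u v) (ℚᵘ.≃-trans (ℚᵘ.+-cong x-y≃p̂z u-v≃p̂w) (ℚᵘ.≃-sym (ℚᵘ.*-distribˡ-+ p̂ z w))))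
    where
    regroup : ∀ x y u v → (x ℚᵘ.+ u) ℚᵘ.- (y ℚᵘ.+ v) ≃ (x ℚᵘ.- y) ℚᵘ.+ (u ℚᵘ.- v)
    regroup = solve 4 (λ x y u v → (x :+ u) :- (y :+ v) := (x :- y) :+ (u :- v)) ℚᵘ.≃-refl

  ∼-trans : ∀ {x y w} → x ∼ y → y ∼ w → x ∼ w
  ∼-trans {x} {y} {w} (p-multiple z p∤z x-y≃p̂z) (p-multiple z′ p∤z′ y-w≃p̂z′) =
    p-multiple (z ℚᵘ.+ z′) (integral-+ {z} {z′} p∤z p∤z′)
      (ℚᵘ.≃-trans (telescope x y w) (ℚᵘ.≃-trans (ℚᵘ.+-cong x-y≃p̂z y-w≃p̂z′) (ℚᵘ.≃-sym (ℚᵘ.*-distribˡ-+ p̂ z z′))))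
    where
    telescope : ∀ x y w → x ℚᵘ.- w ≃ (x ℚᵘ.- y) ℚᵘ.+ (y ℚᵘ.- w)
    telescope = solve 3 (λ x y w → x :- w := (x :- y) :+ (y :- w)) ℚᵘ.≃-refl

  ∼-setoid : Setoid _ _
  ∼-setoid = record
    { Carrier = ℚᵘ ; _≈_ = _∼_
    ; isEquivalence = record { refl = ∼-refl ; sym = ∼-sym ; trans = ∼-trans } }

  open Congruence p using (_≈_; mod∣)

  fromℤ∼fraction : ∀ X Y d → ¬ (p ℕ.∣ suc d) → + suc d * X ≈ Y → fromℤ X ∼ mkℚᵘ Y d
  fromℤ∼fraction X Y d p∤d+1 (mod∣ (divides t [d+1]X-Y≡t*p)) =
    p-multiple (mkℚᵘ t d) p∤d+1 (*≡* (cong (ℤ._* (+ (1 ℕ.* suc d)))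
      (trans (regroup X (+ suc d) Y) (trans [d+1]X-Y≡t*p (ℤ.*-comm t (+ p))))))
    where
    regroup : ∀ X D Y → X * D + (- Y) * + 1 ≡ D * X - Y
    regroup = solve-∀

  sum∼fromℤ∑ : ∀ n (h : ℕ → ℚ) (g : ℕ → ℤ) → (∀ k → k ℕ.< n → toℚᵘ (h k) ∼ fromℤ (g k)) →
               toℚᵘ (foldr ℚ._+_ ℚ.0ℚ (applyUpTo h n)) ∼ fromℤ (∑ n g)
  sum∼fromℤ∑ zero    h g h∼g = ∼-refl
  sum∼fromℤ∑ (suc n) h g h∼g = begin
    toℚᵘ (h 0 ℚ.+ rest)                      ≈⟨ ≃⇒∼ (ℚ.toℚᵘ-homo-+ (h 0) rest) ⟩
    toℚᵘ (h 0) ℚᵘ.+ toℚᵘ rest                   ≈⟨ ∼-+ (h∼g 0 (s≤s z≤n)) (sum∼fromℤ∑ n (h ∘ suc) (g ∘ suc) (λ k k<n → h∼g (suc k) (s≤s k<n))) ⟩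
    fromℤ (g 0) ℚᵘ.+ fromℤ (∑ n (g ∘ suc))      ≈⟨ ≃⇒∼ (fromℤ-+ (g 0) _) ⟩
    fromℤ (∑ (suc n) g)                      ∎
    where
    open SetoidReasoning ∼-setoid
    rest = foldr ℚ._+_ ℚ.0ℚ (applyUpTo (h ∘ suc) n)

  PIntegral-∼fromℤ : ∀ (r : ℚ) b → toℚᵘ r ∼ fromℤ b → PIntegral p r
  PIntegral-∼fromℤ r b (p-multiple z p∤z r-b≃p̂z) p∣↧r =
    integral-+ {p̂ ℚᵘ.* z} {fromℤ b} (integral-* {p̂} {z} p∤1 p∤z) p∤1 (ℕ.∣-trans p∣↧r (↧ₙ∣↧ₙ r _ r≃p̂z+b))
    where
    shift : ∀ x b → x ≃ (x ℚᵘ.- b) ℚᵘ.+ b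
    shift = solve 2 (λ x b → x := (x :- b) :+ b) ℚᵘ.≃-refl
    r≃p̂z+b : toℚᵘ r ≃ p̂ ℚᵘ.* z ℚᵘ.+ fromℤ b
    r≃p̂z+b = ℚᵘ.≃-trans (shift (toℚᵘ r) (fromℤ b)) (ℚᵘ.+-congˡ (fromℤ b) r-b≃p̂z)

  p∣↥ : ∀ (r : ℚ) z → toℚᵘ r ≃ p̂ ℚᵘ.* z → PIntegralᵘ z → p ℕ.∣ ∣ ℚ.↥ r ∣
  p∣↥ (mkℚ n d-1 _) (mkℚᵘ t k) (*≡* n*↧z≡p*t*↧r) p∤↧z
    with euclidsLemma ∣ n ∣ (1 ℕ.* suc k) prime (ℕ.divides (∣ t ∣ ℕ.* suc d-1) eq)
    where
    eq : ∣ n ∣ ℕ.* (1 ℕ.* suc k) ≡ ∣ t ∣ ℕ.* suc d-1 ℕ.* p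
    eq = begin
      ∣ n ∣ ℕ.* (1 ℕ.* suc k)           ≡⟨ ℤ.abs-* n (+ (1 ℕ.* suc k)) ⟨
      ∣ n * + (1 ℕ.* suc k) ∣         ≡⟨ cong ∣_∣ n*↧z≡p*t*↧r ⟩
      ∣ + p * t * + suc d-1 ∣       ≡⟨ ℤ.abs-* (+ p * t) (+ suc d-1) ⟩
      ∣ + p * t ∣ ℕ.* suc d-1         ≡⟨ cong (ℕ._* suc d-1) (ℤ.abs-* (+ p) t) ⟩
      p ℕ.* ∣ t ∣ ℕ.* suc d-1           ≡⟨ rotate p ∣ t ∣ (suc d-1) ⟩
      ∣ t ∣ ℕ.* suc d-1 ℕ.* p           ∎
      where
      open ≡-Reasoning
      rotate : ∀ a b c → a ℕ.* b ℕ.* c ≡ b ℕ.* c ℕ.* a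
      rotate a b c = trans (ℕ.*-assoc a b c) (ℕ.*-comm a (b ℕ.* c))
  ... | inj₁ p∣n    = p∣n
  ... | inj₂ p∣↧z = contradiction (subst (p ℕ.∣_) (ℕ.*-identityˡ (suc k)) p∣↧z) p∤↧z

  p∣↥[r-s] : ∀ (r s : ℚ) → toℚᵘ r ∼ toℚᵘ s → p ℕ.∣ ∣ ℚ.↥ (r ℚ.- s) ∣
  p∣↥[r-s] r s (p-multiple z p∤z r-s≃p̂z) = p∣↥ (r ℚ.- s) z (ℚᵘ.≃-trans toℚᵘ-homo-- r-s≃p̂z) p∤z
    where
    toℚᵘ-homo-- : toℚᵘ (r ℚ.- s) ≃ toℚᵘ r ℚᵘ.- toℚᵘ s
    toℚᵘ-homo-- = ℚᵘ.≃-trans (ℚ.toℚᵘ-homo-+ r (ℚ.- s)) (ℚᵘ.+-congʳ (toℚᵘ r) (ℚ.toℚᵘ-homo‿- s))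

  ∼fromℤ⇒≡[modℚ] : ∀ (r s : ℚ) b → toℚᵘ r ∼ fromℤ b → toℚᵘ s ∼ fromℤ b → r ≡ s [modℚ p ]
  ∼fromℤ⇒≡[modℚ] r s b r∼b s∼b =
    PIntegral-∼fromℤ r b r∼b , PIntegral-∼fromℤ s b s∼b , p∣↥[r-s] r s (∼-trans r∼b (∼-sym s∼b))

[n+n]/2≡n : ∀ n → (n ℕ.+ n) ℕ./ 2 ≡ n
[n+n]/2≡n n = trans (cong (ℕ._/ 2) (trans (cong (n ℕ.+_) (sym (ℕ.+-identityʳ n))) (ℕ.*-comm 2 n))) (m*n/n≡m n 2)

toℚᵘ-/ : ∀ i d → toℚᵘ (i ℚ./ suc d) ≃ mkℚᵘ i d
toℚᵘ-/ i d = ℚ.toℚᵘ-fromℚᵘ (mkℚᵘ i d)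

module OddPrimeCase (n : ℕ) .{{_ : NonZero n}} (prime : Prime (suc (n ℕ.+ n))) where
  open PrimeModulus (n ℕ.+ n) prime
  open OddPrime n prime using (q; 2<p; legendre-1; M; B; im-p≡-1^n+p*B; [2j+1]*M[2j+1]≈1; 2^q-1≡p*B*[im-p+-1^n])
  open LocalCongruence p prime

  sumTerms∼B : toℚᵘ (sumTerms n) ∼ fromℤ B
  sumTerms∼B = subst (λ xs → toℚᵘ (foldr ℚ._+_ ℚ.0ℚ xs) ∼ fromℤ B) (sym (List.map-upTo term n))
                     (sum∼fromℤ∑ n term (λ j → -1^ j * + M (suc (2 ℕ.* j))) term∼)
    where
    term∼ : ∀ j → j ℕ.< n → toℚᵘ (term j) ∼ fromℤ (-1^ j * + M (suc (2 ℕ.* j)))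
    term∼ j j<n = ∼-sym (∼-trans (fromℤ∼fraction _ (-1^ j) (2 ℕ.* j) (0<k<p⇒p∤k (s≤s z≤n) 2j+1<p) numerator≈)
                                 (≃⇒∼ (ℚᵘ.≃-sym (toℚᵘ-/ (-1^ j) (2 ℕ.* j)))))
      where
      open SetoidReasoning ≈-setoid
      2j+1<p : suc (2 ℕ.* j) ℕ.< p
      2j+1<p = s≤s (subst (2 ℕ.* j ℕ.<_) (cong (n ℕ.+_) (ℕ.+-identityʳ n)) (ℕ.*-monoʳ-< 2 j<n))
      swap : ∀ a b c → a * (b * c) ≡ b * (a * c)
      swap = solve-∀
      numerator≈ : + suc (2 ℕ.* j) * (-1^ j * + M (suc (2 ℕ.* j))) ≈ -1^ j
      numerator≈ = begin
        + suc (2 ℕ.* j) * (-1^ j * + M (suc (2 ℕ.* j)))  ≡⟨ swap (+ suc (2 ℕ.* j)) (-1^ j) _ ⟩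
        -1^ j * (+ suc (2 ℕ.* j) * + M (suc (2 ℕ.* j)))  ≈⟨ *-cong (≈-refl { -1^ j}) ([2j+1]*M[2j+1]≈1 j<n) ⟩
        -1^ j * + 1                                      ≡⟨ ℤ.*-identityʳ (-1^ j) ⟩
        -1^ j                                            ∎

  L χ A X : ℤ
  L = legendre (- + 1) p
  χ = -1^ n
  A = im p
  X = + (2 ^ q) - + 1

  R : ℚ
  R = (L ℚ./ 1) ℚ.* ((X ℚ./ 2) ℚ.* (+ 1 ℚ./ p))

  X≡p*B*[A+χ] : X ≡ + p * B * (A + χ)
  X≡p*B*[A+χ] = trans (cong (ℤ._- + 1) (pos-^ 2 q)) 2^q-1≡p*B*[im-p+-1^n]

  L[X/2p]≃LB[A+χ]/2 : mkℚᵘ L 0 ℚᵘ.* (mkℚᵘ X 1 ℚᵘ.* mkℚᵘ (+ 1) q) ≃ mkℚᵘ (L * B * (A + χ)) 1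
  L[X/2p]≃LB[A+χ]/2 = *≡* (begin
    L * (X * + 1) * + 2                       ≡⟨ cong (λ x → L * (x * + 1) * + 2) X≡p*B*[A+χ] ⟩
    L * (+ p * B * (A + χ) * + 1) * + 2 ≡⟨ rearrange L (+ p) B (A + χ) ⟩
    L * B * (A + χ) * (+ 2 * + p)         ≡⟨ cong (L * B * (A + χ) ℤ.*_) (sym (ℤ.pos-* 2 p)) ⟩
    L * B * (A + χ) * + (2 ℕ.* p)           ≡⟨ cong (λ m → L * B * (A + χ) * + m) (sym (ℕ.*-identityˡ (2 ℕ.* p))) ⟩
    L * B * (A + χ) * + (1 ℕ.* (2 ℕ.* p))   ∎)
    where
    open ≡-Reasoning
    rearrange : ∀ L P B C → L * (P * B * C * + 1) * + 2 ≡ L * B * C * (+ 2 * P)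
    rearrange = solve-∀

  R≃LB[A+χ]/2 : toℚᵘ R ≃ mkℚᵘ (L * B * (A + χ)) 1
  R≃LB[A+χ]/2 = begin
    toℚᵘ R
      ≈⟨ ℚ.toℚᵘ-homo-* (L ℚ./ 1) ((X ℚ./ 2) ℚ.* (+ 1 ℚ./ p)) ⟩
    toℚᵘ (L ℚ./ 1) ℚᵘ.* toℚᵘ ((X ℚ./ 2) ℚ.* (+ 1 ℚ./ p))
      ≈⟨ ℚᵘ.*-cong (toℚᵘ-/ L 0) (ℚᵘ.≃-trans (ℚ.toℚᵘ-homo-* (X ℚ./ 2) (+ 1 ℚ./ p)) (ℚᵘ.*-cong (toℚᵘ-/ X 1) (toℚᵘ-/ (+ 1) q))) ⟩
    mkℚᵘ L 0 ℚᵘ.* (mkℚᵘ X 1 ℚᵘ.* mkℚᵘ (+ 1) q)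
      ≈⟨ L[X/2p]≃LB[A+χ]/2 ⟩
    mkℚᵘ (L * B * (A + χ)) 1 ∎
    where open ℚᵘ.≃-Reasoning

  R∼B : toℚᵘ R ∼ fromℤ B
  R∼B = ∼-trans (≃⇒∼ R≃LB[A+χ]/2) (∼-sym (fromℤ∼fraction B (L * B * (A + χ)) 1 (0<k<p⇒p∤k (s≤s z≤n) 2<p) 2B≈LB[A+χ]))
    where
    2B≈LB[A+χ] : + 2 * B ≈ L * B * (A + χ)
    2B≈LB[A+χ] = ≈-sym (begin
      L * B * (A + χ)                            ≡⟨ cong₂ (λ l a → l * B * (a + χ)) legendre-1 im-p≡-1^n+p*B ⟩
      χ * B * ((χ + + p * B) + χ)            ≡⟨ expand χ (+ p) B ⟩
      + 2 * B * (χ * χ) + + p * (χ * B * B) ≈⟨ +-cong (≈-reflexive (cong (+ 2 * B ℤ.*_) (-1^k*-1^k≡1 n))) (m*x≈0 (χ * B * B)) ⟩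
      + 2 * B * + 1 + + 0                       ≡⟨ trans (ℤ.+-identityʳ _) (ℤ.*-identityʳ _) ⟩
      + 2 * B                                        ∎)
      where
      open SetoidReasoning ≈-setoid
      expand : ∀ c P B → c * B * ((c + P * B) + c) ≡ + 2 * B * (c * c) + P * (c * B * B)
      expand = solve-∀

  theorem : sumTerms ((p ∸ 1) ℕ./ 2) ≡ R [modℚ p ]
  theorem = subst (λ k → sumTerms k ≡ R [modℚ p ]) (sym ([n+n]/2≡n n))
                  (∼fromℤ⇒≡[modℚ] (sumTerms n) R B sumTerms∼B R∼B)

2∣2+m+m : ∀ m → 2 ℕ.∣ 2 ℕ.+ (m ℕ.+ m)
2∣2+m+m m = ℕ.divides (suc m) (2+m+m≡[1+m]*2 m)
  where
  2+m+m≡[1+m]*2 : ∀ m → 2 ℕ.+ (m ℕ.+ m) ≡ (1 ℕ.+ m) ℕ.* 2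
  2+m+m≡[1+m]*2 = ℕ-solve-∀

lemma2p3 : (p : ℕ) → .{{_ : NonZero p}} → Prime p → p > 3 →
    sumTerms ((p ∸ 1) ℕ./ 2) ≡ (legendre (ℤ.- (+ 1)) p ℚ./ 1) ℚ.* (((+ (2 ^ (p ∸ 1)) ℤ.- + 1) ℚ./ 2) ℚ.* (+ 1 ℚ./ p)) [modℚ p ]
lemma2p3 (suc q) p-prime p>3 with even-or-odd q
... | zero  , inj₁ refl = contradiction p>3 λ { (s≤s ()) }
... | suc m , inj₁ refl = OddPrimeCase.theorem (suc m) p-prime
... | m , inj₂ refl with prime⇒irreducible p-prime (2∣2+m+m m)
...   | inj₁ ()
...   | inj₂ 2≡p = contradiction (subst (3 ℕ.<_) (sym 2≡p) p>3) λ { (s≤s (s≤s ())) }
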